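{- Let $m\ge 0$, let $s\ge1$ be natural numbers, and let $\Gamma$ be a finite set of ordinals below $\varepsilon_\omega$ with $\max\Gamma<\mathrm{tow}_s(\varepsilon_m)$. (1) If $L_3(\varepsilon_m)$ colours $[\Gamma]^3$ by $1$, then there exists an ordinal estimating function $\Theta$ defined on $\Gamma$ with values in $\{\xi:\xi<\varepsilon_m\}$. (2) If $L_3(\varepsilon_m)$ colours $[\Gamma]^3$ by $2$, then there exists an ordinal estimating function $\Theta$ defined on $\Gamma\setminus\{\min\Gamma\}$ with values in $\{\xi:\xi<\mathrm{tow}_{s-1}(\varepsilon_m)\}$. (3) Let $\gamma_0=\max\Gamma$ and $a=\mathrm{psn}(\gamma_0)$. If $a\ge s-1$ and $L_3(\varepsilon_m)$ colours $[\Gamma]^3$ by $0$, then $$|\Gamma|\le\mathrm{tow}_{s-1}\bigl(\underbrace{\mathrm{tow}_a(\cdots(\mathrm{tow}_a}_{m+1\text{ times}}(a+1))\cdots)\bigr)+1.$$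
   Context: $\varepsilon_{ -1}=\omega$; $\varepsilon_m$ ($m\ge0$) is the $m$-th epsilon number; $\mathrm{tow}_0(x)=1$, $\mathrm{tow}_{n+1}(x)=x^{\mathrm{tow}_n(x)}$ (ordinals and natural numbers). $l(\alpha)=\min\{n:\alpha<\varepsilon_n\}$, $h(\alpha)=\min\{n:\alpha<\mathrm{tow}_n(\varepsilon_{l(\alpha)-1})\}$. For $j\ge-1$, $\alpha$ is in normal form to base $\varepsilon_j$ if $\alpha=\varepsilon_j^{\alpha_0}\xi_0+\dots+\varepsilon_j^{\alpha_s}\xi_s$, $\alpha_0>\dots>\alpha_s$, $0<\xi_i<\varepsilon_j$ (this exists and is unique when $j\ge l(\alpha)-1$); the normal form is the one with $j=l(\alpha)-1$. Pseudonorm: $\mathrm{psn}(\alpha)=\alpha$ for $\alpha<\omega$, else $\max\{h(\alpha),\mathrm{psn}(\alpha_i),\mathrm{psn}(\xi_i)\}$ from the normal form. For $\alpha$ written to base $\varepsilon_m$, $v(\varepsilon_m;\alpha,\delta)$ is the coefficient of $\varepsilon_m^\delta$ (0 if it does not occur), and $\mathrm{LD}(\varepsilon_m;\alpha,\beta)=\max\{\delta:v(\varepsilon_m;\alpha,\delta)\ne v(\varepsilon_m;\beta,\delta)\}$. For $\alpha>\beta>\gamma$, $L_3(\varepsilon_m;\alpha,\beta,\gamma)$ is $0$, $1$ or $2$ according as $\mathrm{LD}(\varepsilon_m;\alpha,\beta)$ is $<$, $=$, or $>$ $\mathrm{LD}(\varepsilon_m;\beta,\gamma)$; "$L_3(\varepsilon_m)$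 colours $[\Gamma]^3$ by $c$" means every 3-element subset of $\Gamma$, listed decreasingly, gets colour $c$. A function $\Theta:\Gamma_0\to\{\xi:\xi<\alpha\}$ is an ordinal ($\alpha$-ordinal) estimating function if it is strictly increasing and $\mathrm{psn}(\Theta(\gamma))\le\mathrm{psn}(\gamma)$ for all $\gamma\in\Gamma_0$. -}

module Defs where

open import Data.Nat using (ℕ; zero; suc; _+_; _∸_; _^_; _≤_; _<_; _⊔_)
open import Data.Nat.Properties using (_≟_)
open import Data.List using (List; []; _∷_; length)
open import Data.List.Relation.Unary.All using (All)
open import Data.List.Relation.Unary.Linked using (Linked)
open import Data.List.Relation.Binary.Pointwise using (Pointwise)
open import Data.List.Membership.Propositional using (_∈_)
open import Data.Product using (Σ; _×_; _,_; ∃₂)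
open import Data.Unit using (⊤)
open import Data.Empty using (⊥)
open import Relation.Binary.PropositionalEquality using (_≡_; _≢_)

-- Ordinal notations for ordinals below ε_ω, following the paper's
-- normal form.
--
--   fin n        : the finite ordinal n
--   ep b ts      : with j = b - 1 (so b = 0 means ε_{-1} = ω, b = k+1
--                  means ε_k), the ordinal
--                     ε_j^{e₀}·c₀ + ε_j^{e₁}·c₁ + … + ε_j^{e_s}·c_s
--                  where ts = (e₀ , c₀) ∷ … ∷ (e_s , c_s) ∷ [].
-- Validity (below) makes this exactly the normal form of the paper
-- (base ε_{l(α)-1}), so every ordinal < ε_ω has exactly one valid code.

data Ord : Set where
  fin : ℕ → Ord
  ep  : ℕ → List (Σ Ord (λ _ → Ord)) → Ord

Terms : Set
Terms = List (Σ Ord (λ _ → Ord))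

data Cmp : Set where
  LT EQ GT : Cmp

cmpℕ : ℕ → ℕ → Cmp
cmpℕ zero    zero    = EQ
cmpℕ zero    (suc _) = LT
cmpℕ (suc _) zero    = GT
cmpℕ (suc m) (suc n) = cmpℕ m n

mutual
  cmp : Ord → Ord → Cmp
  cmp (fin a)   (fin b)   = cmpℕ a b
  cmp (fin _)   (ep _ _)  = LT
  cmp (ep _ _)  (fin _)   = GT
  cmp (ep b xs) (ep c ys) with cmpℕ b c
  ... | LT = LT
  ... | GT = GT
  ... | EQ = cmpL xs ys

  cmpL : Terms → Terms → Cmp
  cmpL []       []       = EQ
  cmpL []       (_ ∷ _)  = LT
  cmpL (_ ∷ _)  []       = GT
  cmpL ((e , c) ∷ xs) ((e' , c') ∷ ys) with cmp e e'
  ... | LT = LT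
  ... | GT = GT
  ... | EQ with cmp c c'
  ...   | LT = LT
  ...   | GT = GT
  ...   | EQ = cmpL xs ys

_<ₒ_ : Ord → Ord → Set
α <ₒ β = cmp α β ≡ LT

-- "the base index of e is ≤ b" : e < ε_{(b-1)+1}
BaseLe : Ord → ℕ → Set
BaseLe (fin _)  b = ⊤
BaseLe (ep c _) b = c ≤ b

-- "the base index of c is < b" : c < ε_{b-1}
BaseLt : Ord → ℕ → Set
BaseLt (fin _)  b = ⊤
BaseLt (ep c _) b = c < b

HeadBelow : Ord → Terms → Set
HeadBelow e []             = ⊤
HeadBelow e ((e' , _) ∷ _) = e' <ₒ e

mutual
  Valid : Ord → Set
  Valid (fin _)               = ⊤
  Valid (ep b [])             = ⊥
  Valid (ep b ((e , c) ∷ ts)) = (e ≢ fin 0) × ValidTerms b ((e , c) ∷ ts)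

  ValidTerms : ℕ → Terms → Set
  ValidTerms b []             = ⊤
  ValidTerms b ((e , c) ∷ ts) =
    Valid e × Valid c × BaseLe e b × BaseLt c b × (c ≢ fin 0) ×
    HeadBelow e ts × ValidTerms b ts

-- tow b n = tow_n(ε_{b-1})  (b = 0 : tow_n(ω))
tow : ℕ → ℕ → Ord
tow b zero    = fin 1
tow b (suc n) = ep b ((tow b n , fin 1) ∷ [])

eps : ℕ → Ord
eps m = tow (suc m) 1

towℕ : ℕ → ℕ → ℕ
towℕ zero    x = 1
towℕ (suc n) x = x ^ towℕ n x

iter : ℕ → (ℕ → ℕ) → ℕ → ℕ
iter zero    f x = x
iter (suc k) f x = f (iter k f x)

-- nesting depth of exponents (used only as a search bound for h)
mutual
  depth : Ord → ℕ
  depth (fin _)   = 0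
  depth (ep _ ts) = suc (depthL ts)

  depthL : Terms → ℕ
  depthL []             = 0
  depthL ((e , _) ∷ ts) = depth e ⊔ depthL ts

searchH : Ord → ℕ → ℕ → ℕ → ℕ
searchH α b n zero    = n
searchH α b n (suc f) with cmp α (tow b n)
... | LT = n
... | _  = searchH α b (suc n) f

-- h(α) = min{ n : α < tow_n(ε_{l(α)-1}) }, for α ≥ ω.
-- For α = ep b ts we have ε_{l(α)-1} = ε_{b-1}; the bound depth α + 2
-- is always large enough (h(α) ≤ depth α + 1).
h : Ord → ℕ
h (fin n)      = 1
h (ep b ts)    = searchH (ep b ts) b 0 (suc (suc (depth (ep b ts))))

mutual
  psn : Ord → ℕ
  psn (fin n)   = n
  psn (ep b ts) = h (ep b ts) ⊔ psnL ts

  psnL : Terms → ℕ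
  psnL []             = 0
  psnL ((e , c) ∷ ts) = psn e ⊔ (psn c ⊔ psnL ts)

-- α written to base ε_m (for α < ε_{m+1}): list of (exponent , coefficient)
toBase : ℕ → Ord → Terms
toBase m (fin zero)    = []
toBase m (fin (suc n)) = (fin 0 , fin (suc n)) ∷ []
toBase m (ep b ts) with cmpℕ b (suc m)
... | LT = (fin 0 , ep b ts) ∷ []
... | _  = ts   -- b = m+1 : the normal form itself
                -- (b > m+1 does not occur for α < ε_{m+1})

lookupCoeff : Ord → Terms → Ord
lookupCoeff δ []             = fin 0
lookupCoeff δ ((e , c) ∷ ts) with cmp δ e
... | EQ = c
... | _  = lookupCoeff δ ts

v : ℕ → Ord → Ord → Ord
v m α δ = lookupCoeff δ (toBase m α)

IsLD : ℕ → Ord → Ord → Ord → Set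
IsLD m α β δ =
  Valid δ × (v m α δ ≢ v m β δ) ×
  ((δ' : Ord) → Valid δ' → δ <ₒ δ' → v m α δ' ≡ v m β δ')

colourOf : Cmp → ℕ
colourOf LT = 0
colourOf EQ = 1
colourOf GT = 2

L3 : ℕ → Ord → Ord → Ord → ℕ → Set
L3 m α β γ c = ∃₂ λ δ₁ δ₂ →
  IsLD m α β δ₁ × IsLD m β γ δ₂ × (colourOf (cmp δ₁ δ₂) ≡ c)

Colours : ℕ → List Ord → ℕ → Set
Colours m Γ c = (α β γ : Ord) → α ∈ Γ → β ∈ Γ → γ ∈ Γ →
  β <ₒ α → γ <ₒ β → L3 m α β γ c

-- Finite sets of ordinals are given as strictly decreasing lists.

_>ₒ_ : Ord → Ord → Set
α >ₒ β = β <ₒ α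

StrictDec : List Ord → Set
StrictDec = Linked _>ₒ_

-- Γ ∖ {min Γ} for a decreasing list Γ
dropLast : List Ord → List Ord
dropLast []           = []
dropLast (x ∷ [])     = []
dropLast (x ∷ y ∷ xs) = x ∷ dropLast (y ∷ xs)

-- An ordinal estimating function Θ : Γ₀ → {ξ : ξ < bound}, Γ₀ given as a
-- strictly decreasing list; Θ is given by the list of its values in the
-- same order (θ_i = Θ(γ_i)).  Strictly increasing Θ ⇔ the value list is
-- strictly decreasing.
EstimatingFn : List Ord → Ord → Set
EstimatingFn Γ₀ bound = Σ (List Ord) λ θ →
  Pointwise (λ γ t → psn t ≤ psn γ) Γ₀ θ ×
  All Valid θ × StrictDec θ × All (λ t → t <ₒ bound) θ

-- Every γ ∈ Γ lies below tow_s(ε_m) ≤ ε_{m+1} and is written to base ε_m.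
-- For consecutive elements γᵢ > γᵢ₊₁ let δᵢ = LD(ε_m; γᵢ, γᵢ₊₁).  The key
-- algebraic fact (ld-coeff-<) is that at δᵢ the coefficient of γᵢ exceeds
-- that of γᵢ₊₁; so δᵢ is an exponent of γᵢ, and exponents and coefficients
-- of γᵢ have pseudonorm at most psn γᵢ.  The colour of (γᵢ, γᵢ₊₁, γᵢ₊₂)
-- says how δᵢ and δᵢ₊₁ compare:
--  (1) colour 1: all δᵢ equal one δ, and Θ(γ) = v(ε_m; γ, δ) is decreasing;
--  (2) colour 2: the δᵢ decrease, and Θ(γᵢ) = δᵢ < tow_{s-1}(ε_m);
--  (3) colour 0: the δᵢ increase and γᵢ agrees with γ₀ above δᵢ, so every
--      δᵢ is an exponent of γ₀.  Replacing ω by a + 1 and each ε_k by a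
--      natural tower (a = psn γ₀) evaluates codes of pseudonorm ≤ a strictly
--      increasingly into ℕ below the tower of the statement; counting the
--      δᵢ gives the bound on |Γ|.

module Submission where

open import Defs
open import Data.Nat using (ℕ; zero; suc; _+_; _*_; _∸_; _^_; _≤_; _<_; z≤n; s≤s)
open import Data.Nat.Properties
open import Data.List using (List; []; _∷_; length; map)
open import Data.List.Properties using (length-map)
open import Data.List.Relation.Unary.All as All using (All; []; _∷_)
open import Data.List.Relation.Unary.Linked as Linked using (Linked; []; [-]; _∷_)
open import Data.List.Relation.Unary.All.Properties using () renaming (map⁺ to All-map⁺)
open import Data.List.Relation.Unary.Linked.Properties using (Linked⇒All) renaming (map⁺ to Linked-map⁺)
open import Data.List.Relation.Binary.Pointwise as Pointwise using (Pointwise; []; _∷_)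
open import Data.List.Membership.Propositional using (_∈_)
open import Data.List.Membership.Propositional.Properties using (∉[])
open import Data.List.Relation.Unary.Any using (here; there)
open import Data.Product using (Σ; _×_; _,_; proj₁; proj₂)
open import Data.Sum using (_⊎_; inj₁; inj₂; [_,_]; map₂)
open import Data.Unit using (tt)
open import Data.Empty using (⊥-elim)
open import Relation.Nullary using (¬_)
open import Relation.Binary.PropositionalEquality
  using (_≡_; _≢_; refl; sym; trans; cong; subst; subst₂)

lex : Cmp → Cmp → Cmp
lex LT _ = LT
lex EQ y = y
lex GT _ = GT

flipC : Cmp → Cmp
flipC LT = GT
flipC EQ = EQ
flipC GT = LT

flip-lex : ∀ x y → flipC (lex x y) ≡ lex (flipC x) (flipC y)
flip-lex LT y = refl
flip-lex EQ y = refl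
flip-lex GT y = refl

lex-EQʳ : ∀ x → lex x EQ ≡ x
lex-EQʳ LT = refl
lex-EQʳ EQ = refl
lex-EQʳ GT = refl

lex-EQ-inv : ∀ x y → lex x y ≡ EQ → x ≡ EQ × y ≡ EQ
lex-EQ-inv EQ y p = refl , p

lex-LT-inv : ∀ x y → lex x y ≡ LT → x ≡ LT ⊎ (x ≡ EQ × y ≡ LT)
lex-LT-inv LT y p = inj₁ refl
lex-LT-inv EQ y p = inj₂ (refl , p)

lex-GT-inv : ∀ x y → lex x y ≡ GT → x ≡ GT ⊎ (x ≡ EQ × y ≡ GT)
lex-GT-inv EQ y p = inj₂ (refl , p)
lex-GT-inv GT y p = inj₁ refl

cmpℕ-refl : ∀ n → cmpℕ n n ≡ EQ
cmpℕ-refl zero    = refl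
cmpℕ-refl (suc n) = cmpℕ-refl n

cmpℕ-EQ : ∀ m n → cmpℕ m n ≡ EQ → m ≡ n
cmpℕ-EQ zero    zero    _ = refl
cmpℕ-EQ (suc m) (suc n) p = cong suc (cmpℕ-EQ m n p)

cmpℕ-LT : ∀ m n → cmpℕ m n ≡ LT → m < n
cmpℕ-LT zero    (suc n) _ = s≤s z≤n
cmpℕ-LT (suc m) (suc n) p = s≤s (cmpℕ-LT m n p)

cmpℕ-< : ∀ m n → m < n → cmpℕ m n ≡ LT
cmpℕ-< zero    (suc n) _       = refl
cmpℕ-< (suc m) (suc n) (s≤s p) = cmpℕ-< m n p

cmpℕ-flip : ∀ m n → cmpℕ n m ≡ flipC (cmpℕ m n)
cmpℕ-flip zero    zero    = refl
cmpℕ-flip zero    (suc n) = refl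
cmpℕ-flip (suc m) zero    = refl
cmpℕ-flip (suc m) (suc n) = cmpℕ-flip m n

cmp-ep : ∀ b xs c ys → cmp (ep b xs) (ep c ys) ≡ lex (cmpℕ b c) (cmpL xs ys)
cmp-ep b xs c ys with cmpℕ b c
... | LT = refl
... | EQ = refl
... | GT = refl

cmpL-cons : ∀ e c xs e' c' ys →
  cmpL ((e , c) ∷ xs) ((e' , c') ∷ ys) ≡ lex (cmp e e') (lex (cmp c c') (cmpL xs ys))
cmpL-cons e c xs e' c' ys with cmp e e'
... | LT = refl
... | GT = refl
... | EQ with cmp c c'
...   | LT = refl
...   | GT = refl
...   | EQ = refl

mutual
  cmp-refl : ∀ α → cmp α α ≡ EQ
  cmp-refl (fin n)   = cmpℕ-refl n
  cmp-refl (ep b ts) rewrite cmp-ep b ts b ts | cmpℕ-refl b = cmpL-refl ts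

  cmpL-refl : ∀ ts → cmpL ts ts ≡ EQ
  cmpL-refl []             = refl
  cmpL-refl ((e , c) ∷ ts)
    rewrite cmpL-cons e c ts e c ts | cmp-refl e | cmp-refl c = cmpL-refl ts

mutual
  cmp-EQ : ∀ α β → cmp α β ≡ EQ → α ≡ β
  cmp-EQ (fin m)   (fin n)   p = cong fin (cmpℕ-EQ m n p)
  cmp-EQ (ep b xs) (ep c ys) p
    with lex-EQ-inv (cmpℕ b c) (cmpL xs ys) (trans (sym (cmp-ep b xs c ys)) p)
  ... | p₁ , p₂ with cmpℕ-EQ b c p₁ | cmpL-EQ xs ys p₂
  ... | refl | refl = refl

  cmpL-EQ : ∀ xs ys → cmpL xs ys ≡ EQ → xs ≡ ys
  cmpL-EQ [] [] p = refl
  cmpL-EQ ((e , c) ∷ xs) ((e' , c') ∷ ys) p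
    with lex-EQ-inv (cmp e e') _ (trans (sym (cmpL-cons e c xs e' c' ys)) p)
  ... | p₁ , p₂ with lex-EQ-inv (cmp c c') _ p₂
  ... | p₃ , p₄ with cmp-EQ e e' p₁ | cmp-EQ c c' p₃ | cmpL-EQ xs ys p₄
  ... | refl | refl | refl = refl

mutual
  cmp-flip : ∀ α β → cmp β α ≡ flipC (cmp α β)
  cmp-flip (fin m)   (fin n)   = cmpℕ-flip m n
  cmp-flip (fin m)   (ep _ _)  = refl
  cmp-flip (ep _ _)  (fin n)   = refl
  cmp-flip (ep b xs) (ep c ys)
    rewrite cmp-ep b xs c ys | cmp-ep c ys b xs | flip-lex (cmpℕ b c) (cmpL xs ys)
          | cmpℕ-flip b c | cmpL-flip xs ys = refl

  cmpL-flip : ∀ xs ys → cmpL ys xs ≡ flipC (cmpL xs ys)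
  cmpL-flip []      []      = refl
  cmpL-flip []      (_ ∷ _) = refl
  cmpL-flip (_ ∷ _) []      = refl
  cmpL-flip ((e , c) ∷ xs) ((e' , c') ∷ ys)
    rewrite cmpL-cons e c xs e' c' ys | cmpL-cons e' c' ys e c xs
          | flip-lex (cmp e e') (lex (cmp c c') (cmpL xs ys))
          | flip-lex (cmp c c') (cmpL xs ys)
          | cmp-flip e e' | cmp-flip c c' | cmpL-flip xs ys = refl

GT→LT : ∀ α β → cmp α β ≡ GT → β <ₒ α
GT→LT α β p rewrite cmp-flip α β | p = refl

LT→GT : ∀ α β → α <ₒ β → cmp β α ≡ GT
LT→GT α β p rewrite cmp-flip α β | p = refl

mutual
  <ₒ-trans : ∀ {α β γ} → α <ₒ β → β <ₒ γ → α <ₒ γ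
  <ₒ-trans {fin a}   {fin b}   {fin c}   p q = cmpℕ-< a c (<-trans (cmpℕ-LT a b p) (cmpℕ-LT b c q))
  <ₒ-trans {fin a}   {fin b}   {ep _ _}  p q = refl
  <ₒ-trans {fin a}   {ep _ _}  {ep _ _}  p q = refl
  <ₒ-trans {ep a xs} {ep b ys} {ep c zs} p q
    rewrite cmp-ep a xs c zs
    with lex-LT-inv (cmpℕ a b) _ (trans (sym (cmp-ep a xs b ys)) p)
       | lex-LT-inv (cmpℕ b c) _ (trans (sym (cmp-ep b ys c zs)) q)
  ... | inj₁ p₁ | inj₁ q₁
      rewrite cmpℕ-< a c (<-trans (cmpℕ-LT a b p₁) (cmpℕ-LT b c q₁)) = refl
  ... | inj₁ p₁ | inj₂ (q₁ , _) rewrite cmpℕ-EQ b c q₁ | p₁ = refl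
  ... | inj₂ (p₁ , _) | inj₁ q₁ rewrite cmpℕ-EQ a b p₁ | q₁ = refl
  ... | inj₂ (p₁ , p₂) | inj₂ (q₁ , q₂)
      rewrite cmpℕ-EQ a b p₁ | cmpℕ-EQ b c q₁ | cmpℕ-refl c = <L-trans xs ys zs p₂ q₂

  <L-trans : ∀ xs ys zs → cmpL xs ys ≡ LT → cmpL ys zs ≡ LT → cmpL xs zs ≡ LT
  <L-trans []      (_ ∷ _) (_ ∷ _) p q = refl
  <L-trans ((e₁ , c₁) ∷ xs) ((e₂ , c₂) ∷ ys) ((e₃ , c₃) ∷ zs) p q
    rewrite cmpL-cons e₁ c₁ xs e₃ c₃ zs
    with lex-LT-inv (cmp e₁ e₂) _ (trans (sym (cmpL-cons e₁ c₁ xs e₂ c₂ ys)) p)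
       | lex-LT-inv (cmp e₂ e₃) _ (trans (sym (cmpL-cons e₂ c₂ ys e₃ c₃ zs)) q)
  ... | inj₁ p₁ | inj₁ q₁ rewrite <ₒ-trans {e₁} {e₂} {e₃} p₁ q₁ = refl
  ... | inj₁ p₁ | inj₂ (q₁ , _) rewrite cmp-EQ e₂ e₃ q₁ | p₁ = refl
  ... | inj₂ (p₁ , _) | inj₁ q₁ rewrite cmp-EQ e₁ e₂ p₁ | q₁ = refl
  ... | inj₂ (p₁ , p₂) | inj₂ (q₁ , q₂)
      rewrite cmp-EQ e₁ e₂ p₁ | cmp-EQ e₂ e₃ q₁ | cmp-refl e₃
      with lex-LT-inv (cmp c₁ c₂) _ p₂ | lex-LT-inv (cmp c₂ c₃) _ q₂
  ... | inj₁ r₁ | inj₁ s₁ rewrite <ₒ-trans {c₁} {c₂} {c₃} r₁ s₁ = refl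
  ... | inj₁ r₁ | inj₂ (s₁ , _) rewrite cmp-EQ c₂ c₃ s₁ | r₁ = refl
  ... | inj₂ (r₁ , _) | inj₁ s₁ rewrite cmp-EQ c₁ c₂ r₁ | s₁ = refl
  ... | inj₂ (r₁ , r₂) | inj₂ (s₁ , s₂)
      rewrite cmp-EQ c₁ c₂ r₁ | cmp-EQ c₂ c₃ s₁ | cmp-refl c₃ = <L-trans xs ys zs r₂ s₂

<ₒ-irrefl : ∀ {α} → ¬ α <ₒ α
<ₒ-irrefl {α} p with trans (sym p) (cmp-refl α)
... | ()

<ₒ⇒≢ : ∀ {α β} → α <ₒ β → α ≢ β
<ₒ⇒≢ {α} p refl = <ₒ-irrefl {α} p

>ₒ⇒≢ : ∀ {α β} → β <ₒ α → α ≢ β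
>ₒ⇒≢ {α} p refl = <ₒ-irrefl {α} p

data Trichotomy (α β : Ord) : Set where
  tri< : α <ₒ β → Trichotomy α β
  tri≈ : α ≡ β  → Trichotomy α β
  tri> : β <ₒ α → Trichotomy α β

trichotomy : ∀ α β → Trichotomy α β
trichotomy α β with cmp α β in eq
... | LT = tri< eq
... | EQ = tri≈ (cmp-EQ α β eq)
... | GT = tri> (GT→LT α β eq)

fin0< : ∀ {c} → c ≢ fin 0 → fin 0 <ₒ c
fin0< {fin zero}    p = ⊥-elim (p refl)
fin0< {fin (suc n)} p = refl
fin0< {ep _ _}      p = refl

not<fin0 : ∀ {c} → ¬ c <ₒ fin 0
not<fin0 {fin zero} ()

vt-exp : ∀ {b e c ts} → ValidTerms b ((e , c) ∷ ts) → Valid e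
vt-exp (ve , _) = ve

vt-coef≢0 : ∀ {b e c ts} → ValidTerms b ((e , c) ∷ ts) → c ≢ fin 0
vt-coef≢0 (_ , _ , _ , _ , nz , _) = nz

vt-tail : ∀ {b e c ts} → ValidTerms b ((e , c) ∷ ts) → ValidTerms b ts
vt-tail (_ , _ , _ , _ , _ , _ , vt) = vt

terms-valid : ∀ {b ts} → Valid (ep b ts) → ValidTerms b ts
terms-valid {ts = _ ∷ _} (_ , vt) = vt

AllBelow : Ord → Terms → Set
AllBelow e ts = All (λ t → proj₁ t <ₒ e) ts

below-weaken : ∀ {e e'} ts → e <ₒ e' → AllBelow e ts → AllBelow e' ts
below-weaken []             e<e' []       = []
below-weaken {e} {e'} ((x , _) ∷ ts) e<e' (x<e ∷ ps) =
  <ₒ-trans {x} {e} {e'} x<e e<e' ∷ below-weaken ts e<e' ps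

vt-below : ∀ {b e c ts} → ValidTerms b ((e , c) ∷ ts) → AllBelow e ts
vt-below {ts = []} _ = []
vt-below {ts = _ ∷ ts} (_ , _ , _ , _ , _ , e₁<e , vt) = e₁<e ∷ below-weaken ts e₁<e (vt-below vt)

lookup-hit : ∀ δ c ts → lookupCoeff δ ((δ , c) ∷ ts) ≡ c
lookup-hit δ c ts with cmp δ δ | cmp-refl δ
... | .EQ | refl = refl

lookup-skip : ∀ {δ e} c ts → δ ≢ e → lookupCoeff δ ((e , c) ∷ ts) ≡ lookupCoeff δ ts
lookup-skip {δ} {e} c ts δ≢e with cmp δ e in eq
... | LT = refl
... | EQ = ⊥-elim (δ≢e (cmp-EQ δ e eq))
... | GT = refl

lookup-above : ∀ {δ} ts → AllBelow δ ts → lookupCoeff δ ts ≡ fin 0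
lookup-above []             []       = refl
lookup-above {δ} ((e , c) ∷ ts) (e<δ ∷ ps) =
  trans (lookup-skip c ts (>ₒ⇒≢ {δ} {e} e<δ)) (lookup-above ts ps)

lookup-cases : ∀ δ ts → lookupCoeff δ ts ≡ fin 0 ⊎ (δ , lookupCoeff δ ts) ∈ ts
lookup-cases-skip : ∀ δ {e} c ts → δ ≢ e →
  lookupCoeff δ ((e , c) ∷ ts) ≡ fin 0 ⊎ (δ , lookupCoeff δ ((e , c) ∷ ts)) ∈ (e , c) ∷ ts

lookup-cases δ [] = inj₁ refl
lookup-cases δ ((e , c) ∷ ts) with trichotomy δ e
... | tri≈ refl = inj₂ (here (cong (δ ,_) (lookup-hit δ c ts)))
... | tri< δ<e  = lookup-cases-skip δ c ts (<ₒ⇒≢ δ<e)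
... | tri> e<δ  = lookup-cases-skip δ c ts (>ₒ⇒≢ {δ} {e} e<δ)

lookup-cases-skip δ c ts δ≢e rewrite lookup-skip c ts δ≢e = map₂ there (lookup-cases δ ts)

VanishesAbove : Ord → Terms → Set
VanishesAbove e A = ∀ δ → e <ₒ δ → lookupCoeff δ A ≡ fin 0

vanishes-mono : ∀ {e e' A} → e <ₒ e' → VanishesAbove e A → VanishesAbove e' A
vanishes-mono {e} {e'} e<e' van δ e'<δ = van δ (<ₒ-trans {e} {e'} {δ} e<e' e'<δ)

vt-vanishes : ∀ {b e c ts} → ValidTerms b ((e , c) ∷ ts) → VanishesAbove e ((e , c) ∷ ts)
vt-vanishes {e = e} {c} {ts} vt δ e<δ =
  trans (lookup-skip c ts (>ₒ⇒≢ {δ} {e} e<δ)) (lookup-above ts (below-weaken ts e<δ (vt-below vt)))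

-- The leading difference of two term lists: the largest exponent at which
-- their coefficients differ (IsLD m α β δ is IsLDL δ on the base-ε_m
-- expansions of α and β).

IsLDL : Ord → Terms → Terms → Set
IsLDL δ A B = Valid δ × (lookupCoeff δ A ≢ lookupCoeff δ B) ×
  ((δ' : Ord) → Valid δ' → δ <ₒ δ' → lookupCoeff δ' A ≡ lookupCoeff δ' B)

ld-unique : ∀ {δ δ' A B} → IsLDL δ A B → IsLDL δ' A B → δ ≡ δ'
ld-unique {δ} {δ'} (vδ , dif , above) (vδ' , dif' , above') with trichotomy δ δ'
... | tri< δ<δ' = ⊥-elim (dif' (above δ' vδ' δ<δ'))
... | tri≈ δ≡δ' = δ≡δ'
... | tri> δ'<δ = ⊥-elim (dif (above' δ vδ δ'<δ))

-- If A and B vanish above e and B has the smaller coefficient at e, then e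
-- is their leading difference, so the comparison at the leading difference
-- δ is the one at e.
leading-at : ∀ {δ e A B} → IsLDL δ A B → Valid e → VanishesAbove e A → VanishesAbove e B →
  lookupCoeff e B <ₒ lookupCoeff e A → lookupCoeff δ B <ₒ lookupCoeff δ A
leading-at {δ} {e} {A} {B} ld ve vanA vanB B<A =
  subst (λ d → lookupCoeff d B <ₒ lookupCoeff d A) (ld-unique {A = A} {B} eIsLD ld) B<A
  where
  eIsLD : IsLDL e A B
  eIsLD = ve , >ₒ⇒≢ {lookupCoeff e A} B<A ,
          λ δ' _ e<δ' → trans (vanA δ' e<δ') (sym (vanB δ' e<δ'))

ld-tail : ∀ {b δ e c A B} → ValidTerms b ((e , c) ∷ A) → ValidTerms b ((e , c) ∷ B) →
  IsLDL δ ((e , c) ∷ A) ((e , c) ∷ B) → δ <ₒ e × IsLDL δ A B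
ld-tail {δ = δ} {e} {c} {A} {B} vA vB (vδ , dif , above) with trichotomy δ e
... | tri≈ refl = ⊥-elim (dif (trans (lookup-hit δ c A) (sym (lookup-hit δ c B))))
... | tri> e<δ = ⊥-elim (dif (trans (vt-vanishes vA δ e<δ) (sym (vt-vanishes vB δ e<δ))))
... | tri< δ<e = δ<e , vδ , dif-tail , above-tail
  where
  skip : ∀ {δ'} ts → δ' ≢ e → lookupCoeff δ' ((e , c) ∷ ts) ≡ lookupCoeff δ' ts
  skip ts = lookup-skip c ts

  transfer : ∀ {δ'} → δ' ≢ e → lookupCoeff δ' ((e , c) ∷ A) ≡ lookupCoeff δ' ((e , c) ∷ B) →
    lookupCoeff δ' A ≡ lookupCoeff δ' B
  transfer δ'≢e eq = trans (sym (skip A δ'≢e)) (trans eq (skip B δ'≢e))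

  dif-tail : lookupCoeff δ A ≢ lookupCoeff δ B
  dif-tail eq = dif (trans (skip A (<ₒ⇒≢ δ<e)) (trans eq (sym (skip B (<ₒ⇒≢ δ<e)))))

  above-tail : ∀ δ' → Valid δ' → δ <ₒ δ' → lookupCoeff δ' A ≡ lookupCoeff δ' B
  above-tail δ' vδ' δ<δ' with trichotomy δ' e
  ... | tri≈ refl = trans (lookup-above A (vt-below vA)) (sym (lookup-above B (vt-below vB)))
  ... | tri< δ'<e = transfer (<ₒ⇒≢ δ'<e) (above δ' vδ' δ<δ')
  ... | tri> e<δ' = transfer (>ₒ⇒≢ {δ'} {e} e<δ') (above δ' vδ' δ<δ')

ld-coeff-< : ∀ {b} A B δ → ValidTerms b A → ValidTerms b B → cmpL A B ≡ GT →
  IsLDL δ A B → lookupCoeff δ B <ₒ lookupCoeff δ A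
ld-coeff-< ((e , c) ∷ A) [] δ vA vB gt (_ , dif , _) = fin0< dif
ld-coeff-< ((e , c) ∷ A) ((e' , c') ∷ B) δ vA vB gt ld
  with lex-GT-inv (cmp e e') _ (trans (sym (cmpL-cons e c A e' c' B)) gt)
... | inj₁ e>e' =
  leading-at ld (vt-exp vA) (vt-vanishes vA) (vanishes-mono {e'} {e} e'<e (vt-vanishes vB))
    (subst₂ _<ₒ_ (sym (vt-vanishes vB e e'<e)) (sym (lookup-hit e c A)) (fin0< (vt-coef≢0 vA)))
  where
  e'<e : e' <ₒ e
  e'<e = GT→LT e e' e>e'
... | inj₂ (e≡e' , rest) with cmp-EQ e e' e≡e' | lex-GT-inv (cmp c c') _ rest
...   | refl | inj₁ c>c' =
  leading-at ld (vt-exp vA) (vt-vanishes vA) (vt-vanishes vB)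
    (subst₂ _<ₒ_ (sym (lookup-hit e c' B)) (sym (lookup-hit e c A)) (GT→LT c c' c>c'))
...   | refl | inj₂ (c≡c' , tails>) with cmp-EQ c c' c≡c'
...     | refl with ld-tail vA vB ld
...       | δ<e , ldTails
  rewrite lookup-skip {δ} c A (<ₒ⇒≢ δ<e) | lookup-skip {δ} c B (<ₒ⇒≢ δ<e) =
  ld-coeff-< A B δ (vt-tail vA) (vt-tail vB) tails> ldTails

BelowNextEps : ℕ → Ord → Set
BelowNextEps m γ = Valid γ × BaseLe γ (suc m)

data BaseView (m : ℕ) : Ord → Set where
  zero-view : BaseView m (fin 0)
  low-view  : ∀ γ → toBase m γ ≡ (fin 0 , γ) ∷ [] → γ ≢ fin 0 → BaseLt γ (suc m) →
              BaseView m γ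
  top-view  : ∀ e c ts → BaseView m (ep (suc m) ((e , c) ∷ ts))

toBase-top : ∀ m ts → toBase m (ep (suc m) ts) ≡ ts
toBase-top m ts rewrite cmpℕ-refl m = refl

toBase-low : ∀ m b ts → b < suc m → toBase m (ep b ts) ≡ (fin 0 , ep b ts) ∷ []
toBase-low m b ts b<m+1 rewrite cmpℕ-< b (suc m) b<m+1 = refl

baseView : ∀ m γ → BelowNextEps m γ → BaseView m γ
baseView m (fin zero)    _ = zero-view
baseView m (fin (suc n)) _ = low-view (fin (suc n)) refl (λ ()) tt
baseView m (ep b ts) (vγ , b≤m+1) with m≤n⇒m<n∨m≡n b≤m+1
... | inj₁ b<m+1 = low-view (ep b ts) (toBase-low m b ts b<m+1) (λ ()) b<m+1
baseView m (ep b ((e , c) ∷ ts)) _ | inj₂ refl = top-view e c ts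

lowBase-< : ∀ m γ ts → BaseLt γ (suc m) → γ <ₒ ep (suc m) ts
lowBase-< m (fin _)   ts _ = refl
lowBase-< m (ep b xs) ts b<m+1 rewrite cmp-ep b xs (suc m) ts | cmpℕ-< b (suc m) b<m+1 = refl

cmp-toBase : ∀ m γ δ → BelowNextEps m γ → BelowNextEps m δ →
  cmp γ δ ≡ cmpL (toBase m γ) (toBase m δ)
cmp-toBase m γ δ gγ gδ with baseView m γ gγ | baseView m δ gδ
... | zero-view | zero-view = refl
... | zero-view | low-view δ q ne _ rewrite q = fin0< ne
... | zero-view | top-view e c ts rewrite toBase-top m ((e , c) ∷ ts) = refl
... | low-view γ q ne _ | zero-view rewrite q = LT→GT (fin 0) γ (fin0< ne)
... | low-view γ q _ _ | low-view δ q' _ _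
    rewrite q | q' | cmpL-cons (fin 0) γ [] (fin 0) δ [] = sym (lex-EQʳ (cmp γ δ))
cmp-toBase m γ δ _ (vδ , _) | low-view γ q _ γ<εm | top-view e c ts
    rewrite q | toBase-top m ((e , c) ∷ ts) | lowBase-< m γ ((e , c) ∷ ts) γ<εm
          | cmpL-cons (fin 0) γ [] e c ts | fin0< (proj₁ vδ) = refl
cmp-toBase m γ δ _ _ | top-view e c ts | zero-view
    rewrite toBase-top m ((e , c) ∷ ts) = refl
cmp-toBase m γ δ (vγ , _) _ | top-view e c ts | low-view δ q _ δ<εm
    rewrite q | toBase-top m ((e , c) ∷ ts) | cmpL-cons e c ts (fin 0) δ []
          | LT→GT (fin 0) e (fin0< (proj₁ vγ)) = LT→GT δ _ (lowBase-< m δ ((e , c) ∷ ts) δ<εm)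
... | top-view e c ts | top-view e' c' ts'
    rewrite toBase-top m ((e , c) ∷ ts) | toBase-top m ((e' , c') ∷ ts')
          | cmp-ep (suc m) ((e , c) ∷ ts) (suc m) ((e' , c') ∷ ts') | cmpℕ-refl m = refl

toBase-valid : ∀ m γ → BelowNextEps m γ → ValidTerms (suc m) (toBase m γ)
toBase-valid m γ gγ@(vγ , _) with baseView m γ gγ
... | zero-view = tt
... | low-view γ q ne γ<εm rewrite q = tt , vγ , tt , γ<εm , ne , tt , tt
... | top-view e c ts rewrite toBase-top m ((e , c) ∷ ts) = proj₂ vγ

term-valid : ∀ {b e c} ts → ValidTerms b ts → (e , c) ∈ ts →
  Valid e × Valid c × BaseLe e b × BaseLt c b
term-valid (_ ∷ ts) (ve , vc , be , bc , _) (here refl) = ve , vc , be , bc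
term-valid (_ ∷ ts) vt                       (there p)   = term-valid ts (vt-tail vt) p

term-psn : ∀ {e c} ts → (e , c) ∈ ts → psn e ≤ psnL ts × psn c ≤ psnL ts
term-psn ((e , c) ∷ ts) (here refl) =
  m≤m⊔n (psn e) _ , ≤-trans (m≤m⊔n (psn c) (psnL ts)) (m≤n⊔m (psn e) _)
term-psn ((e' , c') ∷ ts) (there p) with term-psn ts p
... | pe , pc = ≤-trans pe tail≤ , ≤-trans pc tail≤
  where
  tail≤ : psnL ts ≤ psnL ((e' , c') ∷ ts)
  tail≤ = ≤-trans (m≤n⊔m (psn c') (psnL ts)) (m≤n⊔m (psn e') _)

fin0<tow : ∀ b n → fin 0 <ₒ tow b n
fin0<tow b zero    = refl
fin0<tow b (suc n) = refl

head-below-tow : ∀ b e₀ c₀ ts T → c₀ ≢ fin 0 →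
  ep b ((e₀ , c₀) ∷ ts) <ₒ ep b ((T , fin 1) ∷ []) → e₀ <ₒ T
head-below-tow b e₀ c₀ ts T c₀≢0 lt
  rewrite cmp-ep b ((e₀ , c₀) ∷ ts) b ((T , fin 1) ∷ []) | cmpℕ-refl b
        | cmpL-cons e₀ c₀ ts T (fin 1) []
  with lex-LT-inv (cmp e₀ T) _ lt
... | inj₁ e₀<T = e₀<T
... | inj₂ (_ , rest) with lex-LT-inv (cmp c₀ (fin 1)) _ rest
...   | inj₁ c₀<1 = ⊥-elim (c₀≢0 (below-one c₀<1))
  where
  below-one : ∀ {c} → c <ₒ fin 1 → c ≡ fin 0
  below-one {fin zero}          _  = refl
  below-one {fin (suc zero)}    ()
  below-one {fin (suc (suc _))} ()
...   | inj₂ (_ , ts<[]) = ⊥-elim (nothing<[] ts ts<[])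
  where
  nothing<[] : ∀ A → cmpL A [] ≢ LT
  nothing<[] []      ()
  nothing<[] (_ ∷ _) ()

record ExpansionTerm (m : ℕ) (γ e c : Ord) : Set where
  field
    exp-valid  : Valid e
    exp-base   : BaseLe e (suc m)
    exp-psn    : psn e ≤ psn γ
    coef-valid : Valid c
    coef-small : c <ₒ eps m
    coef-psn   : psn c ≤ psn γ

normal-form-term : ∀ m A {e c} → Valid (ep (suc m) A) → (e , c) ∈ A →
  ExpansionTerm m (ep (suc m) A) e c
normal-form-term m A vγ mem with term-valid A (terms-valid vγ) mem | term-psn A mem
... | ve , vc , be , c<εm | pe , pc = record
  { exp-valid = ve ; exp-base = be ; exp-psn = ≤-trans pe A≤γ
  ; coef-valid = vc ; coef-small = lowBase-< m _ _ c<εm ; coef-psn = ≤-trans pc A≤γ }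
  where
  A≤γ : psnL A ≤ psn (ep (suc m) A)
  A≤γ = m≤n⊔m (h (ep (suc m) A)) (psnL A)

expansion-term : ∀ m γ {e c} → BelowNextEps m γ → (e , c) ∈ toBase m γ → ExpansionTerm m γ e c
expansion-term m γ gγ@(vγ , _) mem with baseView m γ gγ
... | zero-view = ⊥-elim (∉[] mem)
... | low-view γ q _ γ<εm = single (subst (_ ∈_) q mem)
  where
  single : ∀ {e c} → (e , c) ∈ (fin 0 , γ) ∷ [] → ExpansionTerm m γ e c
  single (here refl) = record
    { exp-valid = tt ; exp-base = tt ; exp-psn = z≤n
    ; coef-valid = vγ ; coef-small = lowBase-< m γ _ γ<εm ; coef-psn = ≤-refl }
... | top-view e₀ c₀ ts = normal-form-term m _ vγ (subst (_ ∈_) (toBase-top m _) mem)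

expansion-exp-below : ∀ m s γ {e c} → BelowNextEps m γ → γ <ₒ tow (suc m) (suc s) →
  (e , c) ∈ toBase m γ → e <ₒ tow (suc m) s
expansion-exp-below m s γ gγ@(vγ , _) γ<tow mem with baseView m γ gγ
... | zero-view = ⊥-elim (∉[] mem)
... | low-view γ q _ _ with subst (_ ∈_) q mem
...   | here refl = fin0<tow (suc m) s
expansion-exp-below m s γ (vγ , _) γ<tow mem | top-view e₀ c₀ ts =
  below (subst (_ ∈_) (toBase-top m _) mem)
  where
  vt : ValidTerms (suc m) ((e₀ , c₀) ∷ ts)
  vt = proj₂ vγ
  e₀<tow : e₀ <ₒ tow (suc m) s
  e₀<tow = head-below-tow (suc m) e₀ c₀ ts (tow (suc m) s) (vt-coef≢0 vt) γ<tow
  below : ∀ {e c} → (e , c) ∈ (e₀ , c₀) ∷ ts → e <ₒ tow (suc m) s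
  below (here refl) = e₀<tow
  below {e} (there p) = <ₒ-trans {e} {e₀} {tow (suc m) s} (All.lookup (vt-below vt) p) e₀<tow

below-ep-base : ∀ γ c xs → γ <ₒ ep c xs → BaseLe γ c
below-ep-base (fin _)   c xs _ = tt
below-ep-base (ep b ys) c xs lt with lex-LT-inv (cmpℕ b c) _ (trans (sym (cmp-ep b ys c xs)) lt)
... | inj₁ b<c      = <⇒≤ (cmpℕ-LT b c b<c)
... | inj₂ (b≡c , _) = ≤-reflexive (cmpℕ-EQ b c b≡c)

all-below : ∀ {T x l} → StrictDec (x ∷ l) → x <ₒ T → All (_<ₒ T) (x ∷ l)
all-below sd x<T = Linked⇒All (λ {i} {j} {k} i>j j>k → <ₒ-trans {k} {j} {i} j>k i>j) x<T sd

pointwise-map : ∀ {A B : Set} {P : A → Set} {R : A → B → Set} (f : A → B) →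
  (∀ {x} → P x → R x (f x)) → ∀ {xs} → All P xs → Pointwise R xs (map f xs)
pointwise-map f g []       = []
pointwise-map f g (p ∷ ps) = g p ∷ pointwise-map f g ps

pointwise-right : ∀ {A B : Set} {R : A → B → Set} {P : B → Set} →
  (∀ {x y} → R x y → P y) → ∀ {xs ys} → Pointwise R xs ys → All P ys
pointwise-right g []       = []
pointwise-right g (r ∷ rs) = g r ∷ pointwise-right g rs

linked-with-all : ∀ {A : Set} {P : A → Set} {R S : A → A → Set} →
  (∀ {a b} → P a → P b → R a b → S a b) → ∀ {l} → All P l → Linked R l → Linked S l
linked-with-all f []               []       = []
linked-with-all f (_ ∷ [])         [-]      = [-]
linked-with-all f (p ∷ ps@(q ∷ _)) (r ∷ rs) = f p q r ∷ linked-with-all f ps rs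

increasing-length : ∀ {N} xs → Linked _<_ xs → All (_< N) xs → length xs ≤ N
increasing-length []       _   _  = z≤n
increasing-length (x ∷ xs) inc bs = ≤-trans (m≤m+n (length (x ∷ xs)) x) (go x xs inc bs)
  where
  go : ∀ {N} x xs → Linked _<_ (x ∷ xs) → All (_< N) (x ∷ xs) → length (x ∷ xs) + x ≤ N
  go x []        _          (x<N ∷ [])  = x<N
  go x (y ∷ xs) (x<y ∷ inc) (_ ∷ bs) =
    ≤-trans (≤-reflexive (sym (+-suc (length (y ∷ xs)) x)))
            (≤-trans (+-monoʳ-≤ (length (y ∷ xs)) x<y) (go y xs inc bs))

searchH-≥ : ∀ α b n f → n ≤ searchH α b n f
searchH-≥ α b n zero = ≤-refl
searchH-≥ α b n (suc f) with cmp α (tow b n)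
... | LT = ≤-refl
... | EQ = ≤-trans (n≤1+n n) (searchH-≥ α b (suc n) f)
... | GT = ≤-trans (n≤1+n n) (searchH-≥ α b (suc n) f)

h-pos : ∀ b ts → 1 ≤ h (ep b ts)
h-pos b ts = searchH-≥ (ep b ts) b 1 (suc (depth (ep b ts)))

psn-pos : ∀ γ → γ ≢ fin 0 → 1 ≤ psn γ
psn-pos (fin zero)    γ≢0 = ⊥-elim (γ≢0 refl)
psn-pos (fin (suc n)) _   = s≤s z≤n
psn-pos (ep b ts)     _   = ≤-trans (h-pos b ts) (m≤m⊔n _ _)

ColourLink : ℕ → Ord → Ord → Set
ColourLink c δ δ' = colourOf (cmp δ δ') ≡ c

colour0⇒< : ∀ {δ δ'} → ColourLink 0 δ δ' → δ <ₒ δ'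
colour0⇒< {δ} {δ'} col with cmp δ δ'
colour0⇒< col | LT = refl

colour1⇒≡ : ∀ {δ δ'} → ColourLink 1 δ δ' → δ ≡ δ'
colour1⇒≡ {δ} {δ'} col with cmp δ δ' in eq
colour1⇒≡ {δ} {δ'} col | EQ = cmp-EQ δ δ' eq

colour2⇒> : ∀ {δ δ'} → ColourLink 2 δ δ' → δ' <ₒ δ
colour2⇒> {δ} {δ'} col with cmp δ δ' in eq
colour2⇒> {δ} {δ'} col | GT = GT→LT δ δ' eq

module _ (m : ℕ) where

  ld-coeff : ∀ {x y δ} → BelowNextEps m x → BelowNextEps m y → y <ₒ x → IsLD m x y δ →
    v m y δ <ₒ v m x δ
  ld-coeff {x} {y} {δ} gx gy y<x =
    ld-coeff-< (toBase m x) (toBase m y) δ (toBase-valid m x gx) (toBase-valid m y gy)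
      (trans (sym (cmp-toBase m x y gx gy)) (LT→GT y x y<x))

  ld-nonzero : ∀ {x y δ} → BelowNextEps m x → BelowNextEps m y → y <ₒ x → IsLD m x y δ →
    v m x δ ≢ fin 0
  ld-nonzero {x} {y} {δ} gx gy y<x ld eq =
    not<fin0 {v m y δ} (subst (v m y δ <ₒ_) eq (ld-coeff gx gy y<x ld))

  IsLD-unique : ∀ {x y δ δ'} → IsLD m x y δ → IsLD m x y δ' → δ ≡ δ'
  IsLD-unique {x} {y} = ld-unique {A = toBase m x} {toBase m y}

  CoeffBounds : Ord → Ord → Set
  CoeffBounds γ c = Valid c × psn c ≤ psn γ × c <ₒ eps m

  coeff-bounds : ∀ δ {γ} → BelowNextEps m γ → CoeffBounds γ (v m γ δ)
  coeff-bounds δ {γ} gγ with lookup-cases δ (toBase m γ)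
  ... | inj₁ v≡0 = subst (CoeffBounds γ) (sym v≡0) (tt , z≤n , refl)
  ... | inj₂ mem = coef-valid , coef-psn , coef-small
    where open ExpansionTerm (expansion-term m γ gγ mem)

  record Exponent (s : ℕ) (γ δ : Ord) : Set where
    field
      exponent-valid : Valid δ
      exponent-base  : BaseLe δ (suc m)
      exponent-psn   : psn δ ≤ psn γ
      exponent-below : δ <ₒ tow (suc m) s

  nonzero-exponent : ∀ s {γ δ} → BelowNextEps m γ → γ <ₒ tow (suc m) (suc s) →
    v m γ δ ≢ fin 0 → Exponent s γ δ
  nonzero-exponent s {γ} {δ} gγ γ<tow v≢0 with lookup-cases δ (toBase m γ)
  ... | inj₁ v≡0 = ⊥-elim (v≢0 v≡0)
  ... | inj₂ mem = record
    { exponent-valid = exp-valid ; exponent-base = exp-base ; exponent-psn = exp-psn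
    ; exponent-below = expansion-exp-below m s γ gγ γ<tow mem }
    where open ExpansionTerm (expansion-term m γ gγ mem)

  data LDChain : List Ord → List Ord → Set where
    single : ∀ {x y δ} → IsLD m x y δ → LDChain (x ∷ y ∷ []) (δ ∷ [])
    step   : ∀ {x y l δ θ} → IsLD m x y δ → LDChain (y ∷ l) θ → LDChain (x ∷ y ∷ l) (δ ∷ θ)

  chain-head : ∀ {x y l δ θ} → LDChain (x ∷ y ∷ l) (δ ∷ θ) → IsLD m x y δ
  chain-head (single ld) = ld
  chain-head (step ld _) = ld

  chain-length : ∀ {x l θ} → LDChain (x ∷ l) θ → length l ≡ length θ
  chain-length (single _)  = refl
  chain-length (step _ ch) = cong suc (chain-length ch)

  colour-chain : ∀ {c} x y z l → Colours m (x ∷ y ∷ z ∷ l) c → StrictDec (x ∷ y ∷ z ∷ l) →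
    Σ (List Ord) λ θ → LDChain (x ∷ y ∷ z ∷ l) θ × Linked (ColourLink c) θ
  colour-chain x y z l C sd@(y<x ∷ z<y ∷ _)
    with C x y z (here refl) (there (here refl)) (there (there (here refl))) y<x z<y
  colour-chain x y z [] C sd | δ₁ , δ₂ , ld₁ , ld₂ , col =
    δ₁ ∷ δ₂ ∷ [] , step ld₁ (single ld₂) , col ∷ [-]
  colour-chain x y z (w ∷ l) C (_ ∷ sd) | δ₁ , δ₂ , ld₁ , ld₂ , col
    with colour-chain y z w l (λ α β γ α∈ β∈ γ∈ → C α β γ (there α∈) (there β∈) (there γ∈)) sd
  ... | δ₂' ∷ θ , ch , lin =
    δ₁ ∷ δ₂' ∷ θ , step ld₁ ch ,
    subst (ColourLink _ δ₁) (IsLD-unique {y} {z} ld₂ (chain-head ch)) col ∷ lin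

  coefficients-decrease : ∀ {δ Γ θ} → All (BelowNextEps m) Γ → StrictDec Γ → LDChain Γ θ →
    All (δ ≡_) θ → StrictDec (map (λ γ → v m γ δ) Γ)
  coefficients-decrease (gx ∷ gy ∷ []) (y<x ∷ _) (single ld) (refl ∷ []) =
    ld-coeff gx gy y<x ld ∷ [-]
  coefficients-decrease (gx ∷ gs@(gy ∷ _)) (y<x ∷ sd) (step ld ch) (refl ∷ eqs) =
    ld-coeff gx gy y<x ld ∷ coefficients-decrease gs sd ch eqs

  -- Part (1): Θ(γ) = v(ε_m; γ, δ) for the common LD δ; sets with at most
  -- two elements are handled directly.
  estimating-colour1 : ∀ γ₀ Γ' → All (BelowNextEps m) (γ₀ ∷ Γ') → StrictDec (γ₀ ∷ Γ') →
    Colours m (γ₀ ∷ Γ') 1 → EstimatingFn (γ₀ ∷ Γ') (eps m)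
  estimating-colour1 γ₀ [] _ _ _ = fin 0 ∷ [] , z≤n ∷ [] , tt ∷ [] , [-] , refl ∷ []
  estimating-colour1 γ₀ (γ₁ ∷ []) _ (γ₁<γ₀ ∷ _) _ =
    fin 1 ∷ fin 0 ∷ [] , psn-pos γ₀ γ₀≢0 ∷ z≤n ∷ [] , tt ∷ tt ∷ [] , refl ∷ [-] , refl ∷ refl ∷ []
    where
    γ₀≢0 : γ₀ ≢ fin 0
    γ₀≢0 refl = not<fin0 {γ₁} γ₁<γ₀
  estimating-colour1 γ₀ (γ₁ ∷ γ₂ ∷ l) gs sd C with colour-chain γ₀ γ₁ γ₂ l C sd
  ... | δ ∷ θ , ch , lin =
    map Θ Γ , pointwise-map Θ proj₁ (All.map proj₂ bounds) ,
    All-map⁺ (All.map proj₁ bounds) , coefficients-decrease gs sd ch all≡δ ,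
    All-map⁺ (All.map (λ b → proj₂ (proj₂ b)) bounds)
    where
    Γ : List Ord
    Γ = γ₀ ∷ γ₁ ∷ γ₂ ∷ l
    Θ : Ord → Ord
    Θ γ = v m γ δ
    bounds : All (λ γ → CoeffBounds γ (Θ γ)) Γ
    bounds = All.map (coeff-bounds δ) gs
    all≡δ : All (δ ≡_) (δ ∷ θ)
    all≡δ = Linked⇒All trans refl (Linked.map colour1⇒≡ lin)

  chain-exponents : ∀ s {Γ θ} → LDChain Γ θ → All (BelowNextEps m) Γ → StrictDec Γ →
    All (_<ₒ tow (suc m) (suc s)) Γ → Pointwise (Exponent s) (dropLast Γ) θ
  chain-exponents s (single ld) (gx ∷ gy ∷ []) (y<x ∷ _) (x<tow ∷ _) =
    nonzero-exponent s gx x<tow (ld-nonzero gx gy y<x ld) ∷ []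
  chain-exponents s (step ld ch) (gx ∷ gs@(gy ∷ _)) (y<x ∷ sd) (x<tow ∷ bs) =
    nonzero-exponent s gx x<tow (ld-nonzero gx gy y<x ld) ∷ chain-exponents s ch gs sd bs

  -- Part (2): Θ(γᵢ) = δᵢ, decreasing because the colour is 2.
  estimating-colour2 : ∀ s γ₀ Γ' → All (BelowNextEps m) (γ₀ ∷ Γ') → StrictDec (γ₀ ∷ Γ') →
    All (_<ₒ tow (suc m) (suc s)) (γ₀ ∷ Γ') →
    Colours m (γ₀ ∷ Γ') 2 → EstimatingFn (dropLast (γ₀ ∷ Γ')) (tow (suc m) s)
  estimating-colour2 s γ₀ [] _ _ _ _ = [] , [] , [] , [] , []
  estimating-colour2 s γ₀ (γ₁ ∷ []) _ _ _ _ =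
    fin 0 ∷ [] , z≤n ∷ [] , tt ∷ [] , [-] , fin0<tow (suc m) s ∷ []
  estimating-colour2 s γ₀ (γ₁ ∷ γ₂ ∷ l) gs sd bs C with colour-chain γ₀ γ₁ γ₂ l C sd
  ... | θ , ch , lin =
    θ , Pointwise.map Exponent.exponent-psn exps , pointwise-right Exponent.exponent-valid exps ,
    Linked.map (λ {δ} {δ'} → colour2⇒> {δ} {δ'}) lin , pointwise-right Exponent.exponent-below exps
    where
    exps : Pointwise (Exponent s) (dropLast (γ₀ ∷ γ₁ ∷ γ₂ ∷ l)) θ
    exps = chain-exponents s ch gs sd bs

  -- (3) While the LDs increase, each γᵢ agrees with γ₀ from δᵢ upwards, so
  -- every δᵢ is an exponent of γ₀ with non-zero coefficient.
  AgreesFrom : Ord → Ord → Ord → Set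
  AgreesFrom γ₀ γ δ = ∀ δ' → Valid δ' → δ ≡ δ' ⊎ δ <ₒ δ' → v m γ δ' ≡ v m γ₀ δ'

  agrees-step : ∀ {γ₀ x y δ δ'} → AgreesFrom γ₀ x δ → IsLD m x y δ → δ <ₒ δ' →
    AgreesFrom γ₀ y δ'
  agrees-step {δ = δ} {δ'} agree (_ , _ , above) δ<δ' δ'' vδ'' δ'≤δ'' =
    trans (sym (above δ'' vδ'' δ<δ'')) (agree δ'' vδ'' (inj₂ δ<δ''))
    where
    δ<δ'' : δ <ₒ δ''
    δ<δ'' = [ (λ { refl → δ<δ' }) , <ₒ-trans {δ} {δ'} {δ''} δ<δ' ] δ'≤δ''

  nonzero-at : ∀ {γ₀ x y δ} → AgreesFrom γ₀ x δ → IsLD m x y δ →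
    BelowNextEps m x → BelowNextEps m y → y <ₒ x → v m γ₀ δ ≢ fin 0
  nonzero-at {γ₀} {x} {y} {δ} agree ld gx gy y<x v≡0 =
    ld-nonzero {x} {y} {δ} gx gy y<x ld (trans (agree _ (proj₁ ld) (inj₁ refl)) v≡0)

  increasing-lds-nonzero : ∀ {γ₀ x l δ θ} → AgreesFrom γ₀ x δ → LDChain (x ∷ l) (δ ∷ θ) →
    Linked _<ₒ_ (δ ∷ θ) → All (BelowNextEps m) (x ∷ l) → StrictDec (x ∷ l) →
    All (λ d → v m γ₀ d ≢ fin 0) (δ ∷ θ)
  increasing-lds-nonzero {γ₀} agree (single {x} {y} ld) _ (gx ∷ gy ∷ []) (y<x ∷ _) =
    nonzero-at {γ₀} {x} {y} agree ld gx gy y<x ∷ []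
  increasing-lds-nonzero {γ₀} agree (step {x} {y} ld ch) (δ<δ' ∷ inc) (gx ∷ gs@(gy ∷ _)) (y<x ∷ sd) =
    nonzero-at {γ₀} {x} {y} agree ld gx gy y<x ∷
    increasing-lds-nonzero {γ₀} (agrees-step {γ₀} {x} {y} agree ld δ<δ') ch inc gs sd

  colour0-bound : ∀ s γ₀ Γ' (ev : Ord → ℕ) N → 1 ≤ N →
    (∀ {e} → Exponent s γ₀ e → ev e < N) →
    (∀ {e e'} → Exponent s γ₀ e → Exponent s γ₀ e' → e <ₒ e' → ev e < ev e') →
    All (BelowNextEps m) (γ₀ ∷ Γ') → StrictDec (γ₀ ∷ Γ') → γ₀ <ₒ tow (suc m) (suc s) →
    Colours m (γ₀ ∷ Γ') 0 → length (γ₀ ∷ Γ') ≤ N + 1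
  colour0-bound s γ₀ [] ev N _ _ _ _ _ _ _ = ≤-trans (s≤s z≤n) (m≤n+m 1 N)
  colour0-bound s γ₀ (_ ∷ []) ev N 1≤N _ _ _ _ _ _ = ≤-trans (s≤s 1≤N) (≤-reflexive (+-comm 1 N))
  colour0-bound s γ₀ (γ₁ ∷ γ₂ ∷ l) ev N _ bound mono gs sd γ₀<tow C
    with colour-chain γ₀ γ₁ γ₂ l C sd
  ... | θ@(_ ∷ _) , ch , lin = begin
    length (γ₀ ∷ γ₁ ∷ γ₂ ∷ l) ≡⟨ cong suc (chain-length ch) ⟩
    suc (length θ)            ≡⟨ cong suc (sym (length-map ev θ)) ⟩
    suc (length (map ev θ))   ≤⟨ s≤s (increasing-length (map ev θ) evIncreasing evBounded) ⟩
    suc N                     ≡⟨ +-comm 1 N ⟩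
    N + 1                     ∎
    where
    open ≤-Reasoning
    increasing : Linked _<ₒ_ θ
    increasing = Linked.map (λ {δ} {δ'} → colour0⇒< {δ} {δ'}) lin
    exps : All (Exponent s γ₀) θ
    exps = All.map (nonzero-exponent s (All.head gs) γ₀<tow)
                   (increasing-lds-nonzero {γ₀} (λ _ _ _ → refl) ch increasing gs sd)
    evIncreasing : Linked _<_ (map ev θ)
    evIncreasing = Linked-map⁺ (linked-with-all mono exps increasing)
    evBounded : All (_< N) (map ev θ)
    evBounded = All-map⁺ (All.map bound exps)

-- Towers tow_n(ε_{b-1}) increase with n, and a code of depth d lies below
-- the tower of height d + 1; hence the search defining h succeeds.

below-tow-head : ∀ b e₀ c₀ ts T → e₀ <ₒ T → ep b ((e₀ , c₀) ∷ ts) <ₒ ep b ((T , fin 1) ∷ [])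
below-tow-head b e₀ c₀ ts T e₀<T
  rewrite cmp-ep b ((e₀ , c₀) ∷ ts) b ((T , fin 1) ∷ []) | cmpℕ-refl b
        | cmpL-cons e₀ c₀ ts T (fin 1) [] | e₀<T = refl

tow-mono : ∀ b {n n'} → n < n' → tow b n <ₒ tow b n'
tow-mono b {zero}  {suc n'} _         = refl
tow-mono b {suc n} {suc n'} (s≤s n<n') = below-tow-head b _ _ [] _ (tow-mono b n<n')

below-tow-≤ : ∀ {x} b {n n'} → x <ₒ tow b n → n ≤ n' → x <ₒ tow b n'
below-tow-≤ {x} b {n} {n'} x<tow n≤n' with m≤n⇒m<n∨m≡n n≤n'
... | inj₁ n<n' = <ₒ-trans {x} {tow b n} {tow b n'} x<tow (tow-mono b n<n')
... | inj₂ refl = x<tow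

depth-bound : ∀ α b → Valid α → BaseLe α b → α <ₒ tow b (suc (depth α))
depth-bound (fin _) b _ _ = refl
depth-bound (ep c ((e₀ , c₀) ∷ ts)) b vα c≤b with m≤n⇒m<n∨m≡n c≤b
... | inj₁ c<b rewrite cmp-ep c ((e₀ , c₀) ∷ ts) b ((tow b (depth (ep c ((e₀ , c₀) ∷ ts))) , fin 1) ∷ [])
                     | cmpℕ-< c b c<b = refl
depth-bound (ep c ((e₀ , c₀) ∷ ts)) b (_ , ve₀ , _ , be₀ , _) _ | inj₂ refl =
  below-tow-head c e₀ c₀ ts _
    (below-tow-≤ {e₀} c (depth-bound e₀ c ve₀ be₀) (s≤s (m≤m⊔n (depth e₀) (depthL ts))))

searchH-finds : ∀ α b n f k → α <ₒ tow b (n + k) → k < f → α <ₒ tow b (searchH α b n f)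
searchH-finds α b n (suc f) zero α<tow _ = found (subst (λ j → α <ₒ tow b j) (+-identityʳ n) α<tow)
  where
  found : α <ₒ tow b n → α <ₒ tow b (searchH α b n (suc f))
  found α<towₙ rewrite α<towₙ = α<towₙ
searchH-finds α b n (suc f) (suc k) α<tow (s≤s k<f) with cmp α (tow b n) in eq
... | LT = eq
... | EQ = searchH-finds α b (suc n) f k (subst (λ j → α <ₒ tow b j) (+-suc n k) α<tow) k<f
... | GT = searchH-finds α b (suc n) f k (subst (λ j → α <ₒ tow b j) (+-suc n k) α<tow) k<f

h-bound : ∀ c ts → Valid (ep c ts) → ep c ts <ₒ tow c (h (ep c ts))
h-bound c ts vα = searchH-finds (ep c ts) c 0 (suc (suc (depth (ep c ts))))
  (suc (depth (ep c ts))) (depth-bound (ep c ts) c vα ≤-refl) ≤-refl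

pow-pos : ∀ x t → 1 ≤ x → 1 ≤ x ^ t
pow-pos x zero    1≤x = ≤-refl
pow-pos x (suc t) 1≤x = *-mono-≤ 1≤x (pow-pos x t 1≤x)

pow-mono : ∀ x {t t'} → 1 ≤ x → t ≤ t' → x ^ t ≤ x ^ t'
pow-mono (suc x) _ t≤t' = ^-monoʳ-≤ (suc x) t≤t'

mul-≥ : ∀ P y → 1 ≤ y → P ≤ P * y
mul-≥ P y 1≤y = ≤-trans (≤-reflexive (sym (*-identityʳ P))) (*-monoʳ-≤ P 1≤y)

pow-≥ : ∀ x t → 1 ≤ x → 1 ≤ t → x ≤ x ^ t
pow-≥ x t 1≤x 1≤t = ≤-trans (≤-reflexive (sym (*-identityʳ x))) (pow-mono x 1≤x 1≤t)

tow-pos : ∀ n x → 1 ≤ x → 1 ≤ towℕ n x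
tow-pos zero    x 1≤x = ≤-refl
tow-pos (suc n) x 1≤x = pow-pos x (towℕ n x) 1≤x

tow-≥ : ∀ n x → 1 ≤ x → x ≤ towℕ (suc n) x
tow-≥ n x 1≤x = pow-≥ x (towℕ n x) 1≤x (tow-pos n x 1≤x)

tow-step : ∀ n x → 1 ≤ x → towℕ n x ≤ towℕ (suc n) x
tow-step zero    x 1≤x = pow-pos x 1 1≤x
tow-step (suc n) x 1≤x = pow-mono x 1≤x (tow-step n x 1≤x)

tow-mono-height : ∀ x {n n'} → 1 ≤ x → n ≤ n' → towℕ n x ≤ towℕ n' x
tow-mono-height x {n} {n'} 1≤x n≤n' with m≤n⇒m<n∨m≡n n≤n'
... | inj₂ refl = ≤-refl
tow-mono-height x {n} {suc n'} 1≤x _ | inj₁ (s≤s n≤n'') =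
  ≤-trans (tow-mono-height x 1≤x n≤n'') (tow-step n' x 1≤x)

digit-bound : ∀ B P x T → x < B → T < P → P * x + T < B * P
digit-bound B P x T x<B T<P = begin-strict
  P * x + T   <⟨ +-monoʳ-< (P * x) T<P ⟩
  P * x + P   ≡⟨ trans (+-comm (P * x) P) (sym (*-suc P x)) ⟩
  P * suc x   ≤⟨ *-monoʳ-≤ P x<B ⟩
  P * B       ≡⟨ *-comm P B ⟩
  B * P       ∎
  where open ≤-Reasoning

digit-mono : ∀ P x y T T' → x < y → T < P → P * x + T < P * y + T'
digit-mono P x y T T' x<y T<P = begin-strict
  P * x + T   <⟨ +-monoʳ-< (P * x) T<P ⟩
  P * x + P   ≡⟨ trans (+-comm (P * x) P) (sym (*-suc P x)) ⟩
  P * suc x   ≤⟨ *-monoʳ-≤ P x<y ⟩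
  P * y       ≤⟨ m≤m+n (P * y) T' ⟩
  P * y + T'  ∎
  where open ≤-Reasoning

psn-h : ∀ c ts {z} → psn (ep c ts) ≤ z → h (ep c ts) ≤ z
psn-h c ts = m⊔n≤o⇒m≤o (h (ep c ts)) (psnL ts)

psn-terms : ∀ c ts {z} → psn (ep c ts) ≤ z → psnL ts ≤ z
psn-terms c ts = m⊔n≤o⇒n≤o (h (ep c ts)) (psnL ts)

psn-exp : ∀ e x A {z} → psnL ((e , x) ∷ A) ≤ z → psn e ≤ z
psn-exp e x A = m⊔n≤o⇒m≤o (psn e) _

psn-coef : ∀ e x A {z} → psnL ((e , x) ∷ A) ≤ z → psn x ≤ z
psn-coef e x A p = m⊔n≤o⇒m≤o (psn x) (psnL A) (m⊔n≤o⇒n≤o (psn e) _ p)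

psn-rest : ∀ e x A {z} → psnL ((e , x) ∷ A) ≤ z → psnL A ≤ z
psn-rest e x A p = m⊔n≤o⇒n≤o (psn x) (psnL A) (m⊔n≤o⇒n≤o (psn e) _ p)

-- Fix a bound a on pseudonorms and replace
-- ω by B 0 = a + 1 and ε_k by B (k+1) = tow_a(B k).  On codes of pseudonorm
-- at most a this is strictly increasing, and it maps codes below
-- tow_n(ε_{b-1}) below towℕ n (B b).
module Evaluation (a : ℕ) where

  B : ℕ → ℕ
  B b = iter b (towℕ a) (suc a)

  mutual
    eval : Ord → ℕ
    eval (fin n)   = n
    eval (ep b ts) = evalTerms (B b) ts

    evalTerms : ℕ → Terms → ℕ
    evalTerms X []             = 0
    evalTerms X ((e , c) ∷ ts) = X ^ eval e * eval c + evalTerms X ts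

  a-pos : ∀ c ts → psn (ep c ts) ≤ a → 1 ≤ a
  a-pos c ts p = ≤-trans (h-pos c ts) (psn-h c ts p)

  B-pos : ∀ b → 1 ≤ B b
  B-pos zero    = s≤s z≤n
  B-pos (suc b) = tow-pos a (B b) (B-pos b)

  B-step : 1 ≤ a → ∀ b → B b ≤ B (suc b)
  B-step 1≤a b = ≤-trans (tow-≥ 0 (B b) (B-pos b)) (tow-mono-height (B b) (B-pos b) 1≤a)

  B-≥ : 1 ≤ a → ∀ b → suc a ≤ B b
  B-≥ 1≤a zero    = ≤-refl
  B-≥ 1≤a (suc b) = ≤-trans (B-≥ 1≤a b) (B-step 1≤a b)

  B-mono : 1 ≤ a → ∀ {b b'} → b ≤ b' → B b ≤ B b'
  B-mono 1≤a {b} {b'} b≤b' with m≤n⇒m<n∨m≡n b≤b'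
  ... | inj₂ refl = ≤-refl
  B-mono 1≤a {b} {suc b'} _ | inj₁ (s≤s b≤b'') = ≤-trans (B-mono 1≤a b≤b'') (B-step 1≤a b')

  eval-pos : ∀ α → Valid α → α ≢ fin 0 → 1 ≤ eval α
  eval-pos (fin zero)    _ α≢0 = ⊥-elim (α≢0 refl)
  eval-pos (fin (suc n)) _ _   = s≤s z≤n
  eval-pos (ep c ((e , x) ∷ ts)) (_ , _ , vx , _ , _ , x≢0 , _) _ =
    ≤-trans (*-mono-≤ (pow-pos (B c) (eval e) (B-pos c)) (eval-pos x vx x≢0)) (m≤m+n _ _)

  eval-≥-base : ∀ c ts → Valid (ep c ts) → B c ≤ eval (ep c ts)
  eval-≥-base c ((e , x) ∷ ts) (e≢0 , ve , vx , _ , _ , x≢0 , _) = begin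
    B c                       ≤⟨ pow-≥ (B c) (eval e) (B-pos c) (eval-pos e ve e≢0) ⟩
    B c ^ eval e              ≤⟨ mul-≥ (B c ^ eval e) (eval x) (eval-pos x vx x≢0) ⟩
    B c ^ eval e * eval x     ≤⟨ m≤m+n _ _ ⟩
    eval (ep c ((e , x) ∷ ts)) ∎
    where open ≤-Reasoning

  mutual
    eval-below-next-base : ∀ c ts → Valid (ep c ts) → psn (ep c ts) ≤ a →
      eval (ep c ts) < B (suc c)
    eval-below-next-base c ts vα p = ≤-trans
      (terms-below-tow c ts (h (ep c ts)) vα p (h-bound c ts vα))
      (tow-mono-height (B c) (B-pos c) (psn-h c ts p))

    terms-below-tow : ∀ c ts n → Valid (ep c ts) → psn (ep c ts) ≤ a →
      ep c ts <ₒ tow c n → evalTerms (B c) ts < towℕ n (B c)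
    terms-below-tow c ((e₀ , x₀) ∷ ts) (suc n) (_ , vt@(ve₀ , _ , be₀ , _ , x₀≢0 , _)) p α<tow =
      ≤-trans (terms-below-power c e₀ x₀ ts vt pA)
        (pow-mono (B c) (B-pos c)
          (eval-below-tow c n e₀ ve₀ (psn-exp e₀ x₀ ts pA) be₀
            (head-below-tow c e₀ x₀ ts (tow c n) x₀≢0 α<tow)))
      where
      pA : psnL ((e₀ , x₀) ∷ ts) ≤ a
      pA = psn-terms c ((e₀ , x₀) ∷ ts) p

    eval-below-tow : ∀ b n α → Valid α → psn α ≤ a → BaseLe α b → α <ₒ tow b n →
      eval α < towℕ n (B b)
    eval-below-tow b zero    (fin zero)          _ _ _ _  = s≤s z≤n
    eval-below-tow b zero    (fin (suc zero))    _ _ _ ()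
    eval-below-tow b zero    (fin (suc (suc _))) _ _ _ ()
    eval-below-tow b (suc n) (fin zero)    _ _ _ _ = tow-pos (suc n) (B b) (B-pos b)
    eval-below-tow b (suc n) (fin (suc k)) _ p _ _ =
      ≤-trans (s≤s p) (≤-trans (B-≥ (≤-trans (s≤s z≤n) p) b) (tow-≥ n (B b) (B-pos b)))
    eval-below-tow b (suc n) (ep c ts) vα p c≤b α<tow with m≤n⇒m<n∨m≡n c≤b
    ... | inj₁ c<b = ≤-trans (eval-below-next-base c ts vα p)
                       (≤-trans (B-mono (a-pos c ts p) c<b) (tow-≥ n (B b) (B-pos b)))
    ... | inj₂ refl = terms-below-tow c ts (suc n) vα p α<tow

    terms-below-power : ∀ c e x ts → ValidTerms c ((e , x) ∷ ts) → psnL ((e , x) ∷ ts) ≤ a →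
      evalTerms (B c) ((e , x) ∷ ts) < B c ^ suc (eval e)
    terms-below-power c e x ts (ve , vx , _ , bx , _ , hb , vts) p =
      digit-bound (B c) (B c ^ eval e) (eval x) (evalTerms (B c) ts)
        (coef-below-base c x vx (psn-coef e x ts p) bx)
        (tail-below-power c e ts hb vts (psn-rest e x ts p) ve (psn-exp e x ts p))

    tail-below-power : ∀ c e ts → HeadBelow e ts → ValidTerms c ts → psnL ts ≤ a →
      Valid e → psn e ≤ a → evalTerms (B c) ts < B c ^ eval e
    tail-below-power c e []               _   _  _ _  _  = pow-pos (B c) (eval e) (B-pos c)
    tail-below-power c e ((e₁ , x₁) ∷ ts) e₁<e vt p ve pe =
      ≤-trans (terms-below-power c e₁ x₁ ts vt p)
        (pow-mono (B c) (B-pos c) (eval-mono e₁ e (vt-exp vt) ve (psn-exp e₁ x₁ ts p) pe e₁<e))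

    coef-below-base : ∀ c x → Valid x → psn x ≤ a → BaseLt x c → eval x < B c
    coef-below-base c (fin zero)    _ _ _ = B-pos c
    coef-below-base c (fin (suc k)) _ p _ = ≤-trans (s≤s p) (B-≥ (≤-trans (s≤s z≤n) p) c)
    coef-below-base c (ep c' ts) vx p c'<c =
      ≤-trans (eval-below-next-base c' ts vx p) (B-mono (a-pos c' ts p) c'<c)

    eval-mono : ∀ α β → Valid α → Valid β → psn α ≤ a → psn β ≤ a → α <ₒ β →
      eval α < eval β
    eval-mono (fin k)   (fin k')   _ _ _ _ lt = cmpℕ-LT k k' lt
    eval-mono (fin k)   (ep c ts)  _ vβ pα pβ _ =
      ≤-trans (s≤s pα) (≤-trans (B-≥ (a-pos c ts pβ) c) (eval-≥-base c ts vβ))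
    eval-mono (ep c ts) (ep c' ts') vα vβ pα pβ lt
      with lex-LT-inv (cmpℕ c c') _ (trans (sym (cmp-ep c ts c' ts')) lt)
    ... | inj₁ c<c' = ≤-trans (eval-below-next-base c ts vα pα)
                        (≤-trans (B-mono (a-pos c ts pα) (cmpℕ-LT c c' c<c')) (eval-≥-base c' ts' vβ))
    ... | inj₂ (c≡c' , ts<ts') with cmpℕ-EQ c c' c≡c'
    ...   | refl = terms-mono c ts ts' (terms-valid vα) (terms-valid vβ)
                     (psn-terms c ts pα) (psn-terms c ts' pβ) ts<ts'

    terms-mono : ∀ c A A' → ValidTerms c A → ValidTerms c A' → psnL A ≤ a → psnL A' ≤ a →
      cmpL A A' ≡ LT → evalTerms (B c) A < evalTerms (B c) A'
    terms-mono c [] ((e , y) ∷ A') _ (ve , vy , _ , _ , y≢0 , _) _ _ _ =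
      ≤-trans (*-mono-≤ (pow-pos (B c) (eval e) (B-pos c)) (eval-pos y vy y≢0)) (m≤m+n _ _)
    terms-mono c ((e , x) ∷ A) ((e' , y) ∷ A') vA@(ve , vx , _ , _ , _ , hb , vtA)
               vA'@(ve' , vy , _ , _ , y≢0 , _ , vtA') pA pA' lt
      with lex-LT-inv (cmp e e') _ (trans (sym (cmpL-cons e x A e' y A')) lt)
    ... | inj₁ e<e' =
      ≤-trans (terms-below-power c e x A vA pA)
      (≤-trans (pow-mono (B c) (B-pos c)
                 (eval-mono e e' ve ve' (psn-exp e x A pA) (psn-exp e' y A' pA') e<e'))
      (≤-trans (mul-≥ (B c ^ eval e') (eval y) (eval-pos y vy y≢0)) (m≤m+n _ _)))
    ... | inj₂ (e≡e' , rest) with cmp-EQ e e' e≡e'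
    ...   | refl with lex-LT-inv (cmp x y) _ rest
    ...     | inj₁ x<y =
      digit-mono (B c ^ eval e) (eval x) (eval y) (evalTerms (B c) A) (evalTerms (B c) A')
        (eval-mono x y vx vy (psn-coef e x A pA) (psn-coef e y A' pA') x<y)
        (tail-below-power c e A hb vtA (psn-rest e x A pA) ve (psn-exp e x A pA))
    ...     | inj₂ (x≡y , A<A') with cmp-EQ x y x≡y
    ...       | refl = +-monoʳ-< (B c ^ eval e * eval x)
                  (terms-mono c A A' vtA vtA' (psn-rest e x A pA) (psn-rest e x A' pA') A<A')

-- For s = s' + 1 every element of Γ lies below
-- tow_{s'+1}(ε_m), hence below ε_{m+1}; parts (1) and (2) are the
-- estimating functions built above, and for part (3) the exponents of γ₀
-- are counted through the evaluation with a = psn γ₀, which sends them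
-- strictly increasingly below towℕ s' (B (m + 1)).  (The bound of part (3)
-- holds without the hypothesis s - 1 ≤ psn γ₀.)
mainTheorem13 : (m s : ℕ) → 1 ≤ s → (γ₀ : Ord) → (Γ' : List Ord) →
    All Valid (γ₀ ∷ Γ') → StrictDec (γ₀ ∷ Γ') → γ₀ <ₒ tow (suc m) s →
    (Colours m (γ₀ ∷ Γ') 1 → EstimatingFn (γ₀ ∷ Γ') (eps m)) ×
    (Colours m (γ₀ ∷ Γ') 2 → EstimatingFn (dropLast (γ₀ ∷ Γ')) (tow (suc m) (s ∸ 1))) ×
    (s ∸ 1 ≤ psn γ₀ → Colours m (γ₀ ∷ Γ') 0 →
      length (γ₀ ∷ Γ') ≤ towℕ (s ∸ 1) (iter (suc m) (towℕ (psn γ₀)) (suc (psn γ₀))) + 1)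
mainTheorem13 m (suc s) _ γ₀ Γ' valid sd γ₀<tow =
    estimating-colour1 m γ₀ Γ' small sd
  , estimating-colour2 m s γ₀ Γ' small sd below
  , λ _ → colour0-bound m s γ₀ Γ' eval _ (tow-pos s _ (B-pos (suc m))) bound mono small sd γ₀<tow
  where
  open Evaluation (psn γ₀)
  below : All (_<ₒ tow (suc m) (suc s)) (γ₀ ∷ Γ')
  below = all-below sd γ₀<tow
  small : All (BelowNextEps m) (γ₀ ∷ Γ')
  small = All.zipWith (λ { {γ} (vγ , γ<tow) → vγ , below-ep-base γ (suc m) _ γ<tow }) (valid , below)
  bound : ∀ {e} → Exponent m s γ₀ e → eval e < towℕ s (B (suc m))
  bound {e} ex = eval-below-tow (suc m) s e exponent-valid exponent-psn exponent-base exponent-below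
    where open Exponent ex
  mono : ∀ {e e'} → Exponent m s γ₀ e → Exponent m s γ₀ e' → e <ₒ e' → eval e < eval e'
  mono {e} {e'} ex ex' = eval-mono e e' (Exponent.exponent-valid ex) (Exponent.exponent-valid ex')
                                        (Exponent.exponent-psn ex) (Exponent.exponent-psn ex')
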